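{- Let $G$ be a finite simple graph and let $w_1,v,w_2$ be a simplicial $3$-path in $G$ that is not contained in any induced $4$-cycle of $G$. Then $v$ is a shedding vertex of $G$.
   Context: A chordless path $v_1,\dots,v_k$ is a path whose vertex set induces exactly the path (no edges $v_iv_j$ with $|i-j|\neq 1$). A simplicial $k$-path is a chordless path $v_1,\dots,v_k$ that cannot be extended at both ends to a chordless path $v_0,v_1,\dots,v_k,v_{k+1}$ in $G$. For a vertex $v$, $N(v)$ is its set of neighbors, $N[v]=N(v)\cup\{v\}$, and $G\setminus v$, $G\setminus N[v]$ are the induced subgraphs on the remaining vertices. A shedding vertex is a vertex $v$ such that no independent set of $G\setminus N[v]$ is a maximal independent set of $G\setminus v$. -}

module Defs where

open import Level using (0ℓ)
open import Data.Nat using (ℕ; suc)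
open import Data.Nat.Base using (∣_-_∣)
open import Data.Fin using (Fin; toℕ)
open import Data.Fin.Subset using (Subset; _∈_; _∉_)
open import Data.List using (List; []; _∷_; _++_; length; lookup)
open import Data.Product using (_×_; Σ; ∃; ∃-syntax)
open import Data.Sum using (_⊎_)
open import Relation.Binary.PropositionalEquality using (_≡_; _≢_)
open import Relation.Nullary using (¬_; Dec)
open import Function.Bundles using (_⇔_)

record Graph (n : ℕ) : Set₁ where
  field
    Adj    : Fin n → Fin n → Set
    adj?   : ∀ u v → Dec (Adj u v)
    sym    : ∀ {u v} → Adj u v → Adj v u
    irrefl : ∀ {u} → ¬ Adj u u
open Graph public

module _ {n : ℕ} (G : Graph n) where

  ChordlessPath : List (Fin n) → Set
  ChordlessPath vs =
    (∀ (i j : Fin (length vs)) → lookup vs i ≡ lookup vs j → i ≡ j) ×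
    (∀ (i j : Fin (length vs)) →
       Adj G (lookup vs i) (lookup vs j) ⇔ (∣ toℕ i - toℕ j ∣ ≡ 1))

  SimplicialPath : ℕ → List (Fin n) → Set
  SimplicialPath k vs =
    length vs ≡ k × ChordlessPath vs ×
    ¬ (∃[ v₀ ] ∃[ v' ] ChordlessPath (v₀ ∷ vs ++ (v' ∷ [])))

  InducedC4 : Fin n → Fin n → Fin n → Fin n → Set
  InducedC4 a b c d =
    a ≢ b × a ≢ c × a ≢ d × b ≢ c × b ≢ d × c ≢ d ×
    Adj G a b × Adj G b c × Adj G c d × Adj G d a ×
    ¬ Adj G a c × ¬ Adj G b d

  _∈₄_ : Fin n → (Fin n × Fin n × Fin n × Fin n) → Set
  x ∈₄ (a Data.Product., b Data.Product., c Data.Product., d) =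
    x ≡ a ⊎ x ≡ b ⊎ x ≡ c ⊎ x ≡ d

  ContainedInInducedC4 : List (Fin n) → Set
  ContainedInInducedC4 vs =
    ∃[ a ] ∃[ b ] ∃[ c ] ∃[ d ] InducedC4 a b c d ×
      (∀ (i : Fin (length vs)) → lookup vs i ∈₄ (a Data.Product., b Data.Product., c Data.Product., d))

  Independent : Subset n → Set
  Independent S = ∀ u w → u ∈ S → w ∈ S → ¬ Adj G u w

  -- S is an independent set of G \ N[v]
  IndepInDelNbhd : Fin n → Subset n → Set
  IndepInDelNbhd v S =
    Independent S × (∀ u → u ∈ S → u ≢ v × ¬ Adj G u v)

  -- S is a maximal independent set of G \ v
  MaxIndepInDel : Fin n → Subset n → Set
  MaxIndepInDel v S =
    Independent S × (∀ u → u ∈ S → u ≢ v) ×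
    (∀ u → u ≢ v → u ∉ S → ∃[ w ] (w ∈ S × Adj G u w))

  Shedding : Fin n → Set
  Shedding v = ∀ (S : Subset n) → IndepInDelNbhd v S → ¬ MaxIndepInDel v S

module Submission where

-- Let w₁,v,w₂ be a simplicial 3-path lying on no induced 4-cycle, and suppose
-- some independent set S of G ∖ N[v] were maximal independent in G ∖ v.
-- Both w₁ and w₂ are neighbours of v, hence outside S, so by maximality they
-- have neighbours a ∈ S and b ∈ S respectively; a and b lie outside N[v].
-- If a were adjacent to w₂ (or b to w₁), then w₁,v,w₂,a (or w₁,v,w₂,b) would
-- be an induced 4-cycle through the path; and a, b are non-adjacent since S
-- is independent.  Hence a,w₁,v,w₂,b is a chordless path extending the
-- 3-path at both ends, contradicting simpliciality.

open import Defs
open import Data.Nat using (ℕ; suc; ∣_-_∣)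
open import Data.Fin using (Fin; toℕ; zero; suc)
open import Data.Fin.Subset using (Subset; _∈_)
open import Data.List using (List; []; _∷_; length; lookup)
open import Data.List.Relation.Unary.All as All using (All; []; _∷_)
open import Data.List.Membership.Propositional.Properties using (∈-lookup)
open import Data.Product using (_×_; _,_; proj₁; proj₂; ∃-syntax)
open import Data.Sum using (inj₁; inj₂)
open import Data.Empty using (⊥-elim)
open import Relation.Nullary using (¬_)
open import Relation.Binary.PropositionalEquality using (_≡_; _≢_; refl; cong; ≢-sym)
  renaming (sym to ≡-sym)
open import Function.Bundles using (_⇔_; mk⇔; Equivalence)

module _ {n : ℕ} (G : Graph n) where

  adj⇒≢ : ∀ {x y} → Adj G x y → x ≢ y
  adj⇒≢ xy refl = irrefl G xy

  separated⇒≢ : ∀ {x y z} → Adj G x z → ¬ Adj G y z → x ≢ y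
  separated⇒≢ xz ¬yz refl = ¬yz xz

  adj-sym : ∀ {x y} → Adj G x y → Adj G y x
  adj-sym = Graph.sym G

  ¬adj-sym : ∀ {x y} → ¬ Adj G x y → ¬ Adj G y x
  ¬adj-sym ¬xy yx = ¬xy (adj-sym yx)

  chordless-singleton : ∀ x → ChordlessPath G (x ∷ [])
  chordless-singleton x = distinct , adjacency
    where
    distinct : ∀ (i j : Fin 1) → lookup (x ∷ []) i ≡ lookup (x ∷ []) j → i ≡ j
    distinct zero zero _ = refl

    adjacency : ∀ (i j : Fin 1) →
      Adj G (lookup (x ∷ []) i) (lookup (x ∷ []) j) ⇔ (∣ toℕ i - toℕ j ∣ ≡ 1)
    adjacency zero zero = mk⇔ (λ xx → ⊥-elim (irrefl G xx)) (λ ())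

  chordless-cons : ∀ {a b} {rest : List (Fin n)} →
    Adj G a b → All (λ c → a ≢ c × ¬ Adj G a c) rest →
    ChordlessPath G (b ∷ rest) → ChordlessPath G (a ∷ b ∷ rest)
  chordless-cons {a} {b} {rest} ab far (distinct , adjacency) = distinct′ , adjacency′
    where
    vs : List (Fin n)
    vs = b ∷ rest

    front : ∀ i → Adj G a (lookup vs i) ⇔ (suc (toℕ i) ≡ 1)
    front zero    = mk⇔ (λ _ → refl) (λ _ → ab)
    front (suc k) = mk⇔ (λ e → ⊥-elim (proj₂ (All.lookup far (∈-lookup k)) e)) (λ ())

    fresh : ∀ i → a ≢ lookup vs i
    fresh zero    = adj⇒≢ ab
    fresh (suc k) = proj₁ (All.lookup far (∈-lookup k))

    distinct′ : ∀ (i j : Fin (length (a ∷ vs))) →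
      lookup (a ∷ vs) i ≡ lookup (a ∷ vs) j → i ≡ j
    distinct′ zero    zero    _ = refl
    distinct′ zero    (suc j) e = ⊥-elim (fresh j e)
    distinct′ (suc i) zero    e = ⊥-elim (fresh i (≡-sym e))
    distinct′ (suc i) (suc j) e = cong suc (distinct i j e)

    adjacency′ : ∀ (i j : Fin (length (a ∷ vs))) →
      Adj G (lookup (a ∷ vs) i) (lookup (a ∷ vs) j) ⇔ (∣ toℕ i - toℕ j ∣ ≡ 1)
    adjacency′ zero    zero    = mk⇔ (λ aa → ⊥-elim (irrefl G aa)) (λ ())
    adjacency′ zero    (suc j) = front j
    adjacency′ (suc i) zero    = mk⇔ (λ xa → Equivalence.to (front i) (adj-sym xa))
                                     (λ e → adj-sym (Equivalence.from (front i) e))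
    adjacency′ (suc i) (suc j) = adjacency i j

  chordless₃ : ∀ {x y z} → ChordlessPath G (x ∷ y ∷ z ∷ []) →
    Adj G x y × Adj G y z × ¬ Adj G x z × x ≢ z
  chordless₃ (distinct , adjacency) =
    Equivalence.from (adjacency zero (suc zero)) refl ,
    Equivalence.from (adjacency (suc zero) (suc (suc zero))) refl ,
    (λ xz → two≢one (Equivalence.to (adjacency zero (suc (suc zero))) xz)) ,
    (λ x≡z → first≢last (distinct zero (suc (suc zero)) x≡z))
    where
    two≢one : ¬ (2 ≡ 1)
    two≢one ()

    first≢last : ¬ (zero ≡ suc (suc zero))
    first≢last ()

  OutsideNbhd : Fin n → Fin n → Set
  OutsideNbhd v x = x ≢ v × ¬ Adj G x v

  extend-3path : ∀ {w₁ v w₂ a b} →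
    Adj G w₁ v → Adj G v w₂ → ¬ Adj G w₁ w₂ → w₁ ≢ w₂ →
    OutsideNbhd v a → OutsideNbhd v b →
    Adj G a w₁ → Adj G w₂ b → ¬ Adj G a w₂ → ¬ Adj G w₁ b → ¬ Adj G a b →
    ChordlessPath G (a ∷ w₁ ∷ v ∷ w₂ ∷ b ∷ [])
  extend-3path w₁v vw₂ ¬w₁w₂ w₁≢w₂ (a≢v , ¬av) (b≢v , ¬bv) aw₁ w₂b ¬aw₂ ¬w₁b ¬ab =
    chordless-cons aw₁
      ((a≢v , ¬av) ∷ (separated⇒≢ aw₁ (¬adj-sym ¬w₁w₂) , ¬aw₂)
                   ∷ (separated⇒≢ aw₁ (¬adj-sym ¬w₁b) , ¬ab) ∷ [])
    (chordless-cons w₁v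
      ((w₁≢w₂ , ¬w₁w₂) ∷ (separated⇒≢ w₁v ¬bv , ¬w₁b) ∷ [])
    (chordless-cons vw₂
      ((≢-sym b≢v , ¬adj-sym ¬bv) ∷ [])
    (chordless-cons w₂b [] (chordless-singleton _))))

  common-neighbour⇒C4 : ∀ {w₁ v w₂ x} →
    Adj G w₁ v → Adj G v w₂ → ¬ Adj G w₁ w₂ → w₁ ≢ w₂ →
    OutsideNbhd v x → Adj G w₁ x → Adj G w₂ x →
    ContainedInInducedC4 G (w₁ ∷ v ∷ w₂ ∷ [])
  common-neighbour⇒C4 {w₁} {v} {w₂} {x} w₁v vw₂ ¬w₁w₂ w₁≢w₂ (x≢v , ¬xv) w₁x w₂x =
    w₁ , v , w₂ , x ,
    (adj⇒≢ w₁v , w₁≢w₂ , adj⇒≢ w₁x , adj⇒≢ vw₂ , ≢-sym x≢v , adj⇒≢ w₂x ,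
     w₁v , vw₂ , w₂x , adj-sym w₁x , ¬w₁w₂ , ¬adj-sym ¬xv) ,
    onCycle
    where
    onCycle : ∀ i → _∈₄_ G (lookup (w₁ ∷ v ∷ w₂ ∷ []) i) (w₁ , v , w₂ , x)
    onCycle zero             = inj₁ refl
    onCycle (suc zero)       = inj₂ (inj₁ refl)
    onCycle (suc (suc zero)) = inj₂ (inj₂ (inj₁ refl))

  dominated : ∀ {v u} (S : Subset n) → IndepInDelNbhd G v S → MaxIndepInDel G v S →
    Adj G u v → ∃[ x ] (x ∈ S × Adj G u x)
  dominated {u = u} S (_ , outside) (_ , _ , maximal) uv =
    maximal u (adj⇒≢ uv) (λ u∈S → proj₂ (outside u u∈S) uv)

lemma4p2 : ∀ {n : ℕ} (G : Graph n) (w₁ v w₂ : Fin n) →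
    SimplicialPath G 3 (w₁ ∷ v ∷ w₂ ∷ []) →
    ¬ ContainedInInducedC4 G (w₁ ∷ v ∷ w₂ ∷ []) →
    Shedding G v
lemma4p2 G w₁ v w₂ (_ , path , unextendable) noC4 S avoidsN[v] maximal
  with chordless₃ G path
... | w₁v , vw₂ , ¬w₁w₂ , w₁≢w₂
  with dominated G S avoidsN[v] maximal w₁v
     | dominated G S avoidsN[v] maximal (adj-sym G vw₂)
... | a , a∈S , w₁a | b , b∈S , w₂b =
  unextendable (a , b ,
    extend-3path G w₁v vw₂ ¬w₁w₂ w₁≢w₂ a-outside b-outside
      (adj-sym G w₁a) w₂b ¬aw₂ ¬w₁b (proj₁ avoidsN[v] a b a∈S b∈S))
  where
  a-outside : OutsideNbhd G v a
  a-outside = proj₂ avoidsN[v] a a∈S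

  b-outside : OutsideNbhd G v b
  b-outside = proj₂ avoidsN[v] b b∈S

  -- a ~ w₂ or b ~ w₁ would place the path on an induced 4-cycle.
  ¬aw₂ : ¬ Adj G a w₂
  ¬aw₂ aw₂ = noC4 (common-neighbour⇒C4 G w₁v vw₂ ¬w₁w₂ w₁≢w₂ a-outside w₁a (adj-sym G aw₂))

  ¬w₁b : ¬ Adj G w₁ b
  ¬w₁b w₁b = noC4 (common-neighbour⇒C4 G w₁v vw₂ ¬w₁w₂ w₁≢w₂ b-outside w₁b w₂b)
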